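{- Let $(f,C)$ and $(g,D)$ be low-defect pairs. If $\delta(f,C)=\delta(g,D)$, then $C\equiv D\pmod 3$.
   Context: $\|n\|$ denotes the integer complexity of $n\in\mathbb{N}$ (least number of $1$'s needed to write $n$ using $1$, $+$, $\cdot$ and parentheses). The set of low-defect pairs is the smallest subset $\mathscr{P}$ of $\mathbb{Z}[x_1,x_2,\ldots]\times\mathbb{N}$ such that: (i) for every constant $k\in\mathbb{N}$ and every $C\ge\|k\|$, $(k,C)\in\mathscr{P}$; (ii) if $(f_1,C_1),(f_2,C_2)\in\mathscr{P}$ with $f_1$ in $d_1$ variables and $f_2$ in $d_2$ variables, then $(f_1\otimes f_2,C_1+C_2)\in\mathscr{P}$, where $(f_1\otimes f_2)(x_1,\ldots,x_{d_1+d_2})=f_1(x_1,\ldots,x_{d_1})f_2(x_{d_1+1},\ldots,x_{d_1+d_2})$; (iii) if $(f,C)\in\mathscr{P}$ with $f$ in $d$ variables, $c\in\mathbb{N}$ and $D\ge\|c\|$, then $(f\cdot x_{d+1}+c,\,C+D)\in\mathscr{P}$. The first coordinates are low-defect polynomials; such a polynomial of degree $d$ is multilinear in $x_1,\ldots,x_d$ with nonzero coefficient of $x_1\cdots x_d$, called its leading coefficient. For a low-defect pair $(f,C)$ with leading coefficient $a$, its defect is $\delta(f,C)=C-3\log_3 a$. -}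

module Defs where

open import Data.Nat using (ℕ; zero; suc; _+_; _*_; _^_; _≤_)
open import Data.Product using (Σ; _×_)

data Expr : Set where
  one  : Expr
  _⊕_  : Expr → Expr → Expr
  _⊗ᵉ_ : Expr → Expr → Expr

value : Expr → ℕ
value one       = 1
value (e ⊕ e′)  = value e + value e′
value (e ⊗ᵉ e′) = value e * value e′

ones : Expr → ℕ
ones one       = 1
ones (e ⊕ e′)  = ones e + ones e′
ones (e ⊗ᵉ e′) = ones e + ones e′

ComplexityAtMost : ℕ → ℕ → Set
ComplexityAtMost k C = Σ Expr λ e → (value e ≡ k) × (ones e ≤ C)
  where open import Relation.Binary.PropositionalEquality using (_≡_)

-- Low-defect pairs, as derivations following rules (i)–(iii).
-- LowDefect d C : a low-defect pair (f , C) with f in d variables (degree d).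
data LowDefect : ℕ → ℕ → Set where
  const : (k C : ℕ) → ComplexityAtMost k C → LowDefect 0 C
  tensor : ∀ {d₁ d₂ C₁ C₂} → LowDefect d₁ C₁ → LowDefect d₂ C₂
         → LowDefect (d₁ + d₂) (C₁ + C₂)
  extend : ∀ {d C} → LowDefect d C → (c D : ℕ) → ComplexityAtMost c D
         → LowDefect (suc d) (C + D)

-- Leading coefficient (coefficient of x₁⋯x_d) of the polynomial of the pair:
-- for k it is k; for f₁ ⊗ f₂ it is the product; for f·x_{d+1}+c it is that of f.
leading : ∀ {d C} → LowDefect d C → ℕ
leading (const k C _)    = k
leading (tensor p q)     = leading p * leading q
leading (extend p c D _) = leading p

-- Equality of defects δ(f,C) = C − 3 log₃ a and δ(g,D) = D − 3 log₃ b,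
-- expressed without real numbers: C − 3log₃a = D − 3log₃b  ⇔  3^C · b³ = 3^D · a³.
SameDefect : ∀ {d e C D} → LowDefect d C → LowDefect e D → Set
SameDefect {C = C} {D = D} p q =
  3 ^ C * (leading q ^ 3) ≡ 3 ^ D * (leading p ^ 3)
  where open import Relation.Binary.PropositionalEquality using (_≡_)

{-# OPTIONS --safe #-}

-- Leading coefficients of low-defect pairs are positive, so write them as
-- a = 3^i a′ and b = 3^j b′ with 3 ∤ a′, b′. Equal defects mean
-- 3^C b³ = 3^D a³, i.e. 3^(C+3j) b′³ = 3^(D+3i) a′³ where 3 ∤ a′³, b′³ because
-- 3 is prime. Comparing 3-adic valuations gives C + 3j = D + 3i, hence C ≡ D (mod 3).
module Submission where

open import Defs
open import Data.Nat using (ℕ; _%_)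
open import Relation.Binary.PropositionalEquality using (_≡_)

open import Data.Nat.Base
  using (zero; suc; _+_; _*_; _^_; _<_; NonZero; NonTrivial; >-nonZero; >-nonZero⁻¹; nonTrivial⇒≢1)
open import Data.Nat.DivMod using ([m+kn]%n≡m%n)
open import Data.Nat.Divisibility
  using (_∣_; _∤_; _∣?_; ∣1⇒≡1; m∣m*n; ∣m⇒∣m*n; m∣n⇒n≡m*quotient; quotient; quotient≢0; quotient-<)
open import Data.Nat.Induction using (<-wellFounded)
open import Data.Nat.Primality using (Prime; prime?; prime⇒nonTrivial; euclidsLemma)
open import Data.Nat.Properties
  using ( *-identityˡ; *-assoc; *-cancelˡ-≡; m*n≢0; m≤m+n; <-≤-trans
        ; ^-*-assoc; ^-distribˡ-+-*; +-*-commutativeSemiring)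
open import Algebra.Properties.CommutativeSemiring.Exp +-*-commutativeSemiring using (^-distrib-*)
open import Data.Product using (_,_)
open import Data.Sum using ([_,_])
open import Induction.WellFounded using (Acc; acc)
open import Relation.Binary.PropositionalEquality
  using (refl; sym; trans; cong; subst; module ≡-Reasoning)
open import Relation.Nullary using (yes; no; contradiction)
open import Relation.Nullary.Decidable using (from-yes)

value≢0 : ∀ e → NonZero (value e)
value≢0 one       = _
value≢0 (e ⊕ e′)  = >-nonZero (<-≤-trans (>-nonZero⁻¹ _ {{value≢0 e}}) (m≤m+n _ _))
value≢0 (e ⊗ᵉ e′) = m*n≢0 _ _ {{value≢0 e}} {{value≢0 e′}}

leading≢0 : ∀ {d C} (f : LowDefect d C) → NonZero (leading f)
leading≢0 (const k C (e , refl , _)) = value≢0 e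
leading≢0 (tensor f g)               = m*n≢0 _ _ {{leading≢0 f}} {{leading≢0 g}}
leading≢0 (extend f c D _)           = leading≢0 f

record Split (p n : ℕ) : Set where
  field
    exponent              : ℕ
    cofactor              : ℕ
    p∤cofactor            : p ∤ cofactor
    n≡p^exponent*cofactor : n ≡ p ^ exponent * cofactor

open Split

split : ∀ p .{{_ : NonTrivial p}} n .{{_ : NonZero n}} → Split p n
split p n = go n (<-wellFounded n)
  where
  go : ∀ n .{{_ : NonZero n}} → Acc _<_ n → Split p n
  go n (acc rec) with p ∣? n
  ... | no p∤n = record
    { exponent              = 0
    ; cofactor              = n
    ; p∤cofactor            = p∤n
    ; n≡p^exponent*cofactor = sym (*-identityˡ n)
    }
  ... | yes p∣n = record
    { exponent              = suc (exponent s)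
    ; cofactor              = cofactor s
    ; p∤cofactor            = p∤cofactor s
    ; n≡p^exponent*cofactor = begin
        n                                 ≡⟨ m∣n⇒n≡m*quotient p∣n ⟩
        p * quotient p∣n                  ≡⟨ cong (p *_) (n≡p^exponent*cofactor s) ⟩
        p * (p ^ exponent s * cofactor s) ≡⟨ *-assoc p _ _ ⟨
        p ^ suc (exponent s) * cofactor s ∎
    }
    where
    open ≡-Reasoning
    instance _ = quotient≢0 p∣n
    s : Split p (quotient p∣n)
    s = go (quotient p∣n) (rec (quotient-< p∣n))

p^i*x≡p^j*y⇒i≡j : ∀ {p i j x y} .{{_ : NonZero p}} → p ∤ x → p ∤ y →
                  p ^ i * x ≡ p ^ j * y → i ≡ j
p^i*x≡p^j*y⇒i≡j {i = zero} {zero} _ _ _ = refl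
p^i*x≡p^j*y⇒i≡j {p} {zero} {suc j} {x} {y} p∤x _ eq =
  contradiction (subst (p ∣_) (trans (sym eq) (*-identityˡ x)) (∣m⇒∣m*n y (m∣m*n (p ^ j)))) p∤x
p^i*x≡p^j*y⇒i≡j {i = suc i} {zero} p∤x p∤y eq = sym (p^i*x≡p^j*y⇒i≡j p∤y p∤x (sym eq))
p^i*x≡p^j*y⇒i≡j {p} {suc i} {suc j} {x} {y} p∤x p∤y eq =
  cong suc (p^i*x≡p^j*y⇒i≡j p∤x p∤y (*-cancelˡ-≡ _ _ p (begin
    p * (p ^ i * x) ≡⟨ *-assoc p _ _ ⟨
    p ^ suc i * x   ≡⟨ eq ⟩
    p ^ suc j * y   ≡⟨ *-assoc p _ _ ⟩
    p * (p ^ j * y) ∎)))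
  where open ≡-Reasoning

exponent-unique : ∀ {p m n} .{{_ : NonZero p}} (s : Split p m) (t : Split p n) →
                  m ≡ n → exponent s ≡ exponent t
exponent-unique s t m≡n = p^i*x≡p^j*y⇒i≡j (p∤cofactor s) (p∤cofactor t)
  (trans (sym (n≡p^exponent*cofactor s)) (trans m≡n (n≡p^exponent*cofactor t)))

prime∤⇒∤^ : ∀ {p x} → Prime p → p ∤ x → ∀ n → p ∤ x ^ n
prime∤⇒∤^ pp _ zero p∣1 = contradiction (∣1⇒≡1 p∣1) (nonTrivial⇒≢1 {{prime⇒nonTrivial pp}})
prime∤⇒∤^ {x = x} pp p∤x (suc n) p∣x^[1+n] =
  [ p∤x , prime∤⇒∤^ pp p∤x n ] (euclidsLemma x (x ^ n) pp p∣x^[1+n])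

p^*cube-split : ∀ {p b} → Prime p → ∀ C → (s : Split p b) → Split p (p ^ C * b ^ 3)
p^*cube-split {p} {b} pp C s = record
  { exponent              = C + e * 3
  ; cofactor              = c ^ 3
  ; p∤cofactor            = prime∤⇒∤^ pp (p∤cofactor s) 3
  ; n≡p^exponent*cofactor = begin
      p ^ C * b ^ 3                 ≡⟨ cong (λ b → p ^ C * b ^ 3) (n≡p^exponent*cofactor s) ⟩
      p ^ C * (p ^ e * c) ^ 3       ≡⟨ cong (p ^ C *_) (^-distrib-* (p ^ e) c 3) ⟩
      p ^ C * ((p ^ e) ^ 3 * c ^ 3) ≡⟨ cong (λ t → p ^ C * (t * c ^ 3)) (^-*-assoc p e 3) ⟩
      p ^ C * (p ^ (e * 3) * c ^ 3) ≡⟨ *-assoc (p ^ C) _ _ ⟨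
      p ^ C * p ^ (e * 3) * c ^ 3   ≡⟨ cong (_* c ^ 3) (^-distribˡ-+-* p C (e * 3)) ⟨
      p ^ (C + e * 3) * c ^ 3       ∎
  }
  where
  open ≡-Reasoning
  e c : ℕ
  e = exponent s
  c = cofactor s

3-prime : Prime 3
3-prime = from-yes (prime? 3)

proposition2p18 : ∀ {d e C D} (f : LowDefect d C) (g : LowDefect e D)
    → SameDefect f g → C % 3 ≡ D % 3
proposition2p18 {C = C} {D = D} f g same = begin
  C % 3                     ≡⟨ [m+kn]%n≡m%n C (exponent sg) 3 ⟨
  (C + exponent sg * 3) % 3 ≡⟨ cong (_% 3) exponents-agree ⟩
  (D + exponent sf * 3) % 3 ≡⟨ [m+kn]%n≡m%n D (exponent sf) 3 ⟩
  D % 3                     ∎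
  where
  open ≡-Reasoning
  sf : Split 3 (leading f)
  sf = split 3 (leading f) {{leading≢0 f}}
  sg : Split 3 (leading g)
  sg = split 3 (leading g) {{leading≢0 g}}
  exponents-agree : C + exponent sg * 3 ≡ D + exponent sf * 3
  exponents-agree = exponent-unique (p^*cube-split 3-prime C sg) (p^*cube-split 3-prime D sf) same
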